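{- The following rules are admissible in $\mathbf{C}_2$ (i.e. whenever their premises are derivable in $\mathbf{C}_2$, so is their conclusion): (IO-Wk) from $G\vdash(B,Y)$ infer $(A,X),G\vdash(B,Y)$; (IO-Ctr) from $(A,X),(A,X),G\vdash(B,Y)$ infer $(A,X),G\vdash(B,Y)$; (IO-Cut) from $G\vdash(C,Z)$ and $(C,Z),G'\vdash(B,Y)$ infer $G,G'\vdash(B,Y)$.
   Context: Formulas are classical propositional formulas; $\models$ is classical entailment. An LK sequent $\Gamma\Rightarrow\Delta$ is derivable in LK iff $\bigwedge\Gamma\models\bigvee\Delta$ (empty conjunction $=\top$, empty disjunction $=\bot$). An I/O pair is an ordered pair $(A,X)$ of formulas; an I/O sequent has the form $G\vdash(B,Y)$ with $G$ a finite multiset of pairs ($G,G'$ denotes multiset union). The calculus $\mathbf{C}_2$ has the rules: (IN) from $B\Rightarrow$ infer $G\vdash(B,Y)$; (OUT) from $\Rightarrow Y$ infer $G\vdash(B,Y)$; (E2) from $G\vdash(B\wedge\neg A,Y)$ and $G\vdash(B,Y\vee\neg X)$ infer $(A,X),G\vdash(B,Y)$. An I/O sequent is derivable in $\mathbf{C}_2$ if it is the root of a finite tree built with these rules in which every LK-sequent premise is derivable in LK. -}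

module Defs where

open import Data.Nat using (ℕ)
open import Data.Bool using (Bool; true; false; _∧_; _∨_; not)
open import Data.List using (List; []; _∷_; _++_; foldr)
open import Data.Product using (_×_; _,_)
open import Relation.Binary.PropositionalEquality using (_≡_)
open import Data.List.Relation.Binary.Permutation.Propositional using (_↭_)

data Fm : Set where
  atom : ℕ → Fm
  ⊤f ⊥f : Fm
  ¬f_ : Fm → Fm
  _∧f_ _∨f_ _→f_ : Fm → Fm → Fm

Valuation : Set
Valuation = ℕ → Bool

⟦_⟧ : Fm → Valuation → Bool
⟦ atom n ⟧ v = v n
⟦ ⊤f ⟧ v = true
⟦ ⊥f ⟧ v = false
⟦ ¬f A ⟧ v = not (⟦ A ⟧ v)
⟦ A ∧f B ⟧ v = ⟦ A ⟧ v ∧ ⟦ B ⟧ v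
⟦ A ∨f B ⟧ v = ⟦ A ⟧ v ∨ ⟦ B ⟧ v
⟦ A →f B ⟧ v = not (⟦ A ⟧ v) ∨ ⟦ B ⟧ v

_⊨_ : Fm → Fm → Set
A ⊨ B = ∀ (v : Valuation) → ⟦ A ⟧ v ≡ true → ⟦ B ⟧ v ≡ true

⋀ : List Fm → Fm
⋀ = foldr _∧f_ ⊤f

⋁ : List Fm → Fm
⋁ = foldr _∨f_ ⊥f

LKDerivable : List Fm → List Fm → Set
LKDerivable Γ Δ = ⋀ Γ ⊨ ⋁ Δ

-- I/O pairs and contexts (finite multisets, represented by lists up to permutation)
Pair : Set
Pair = Fm × Fm

Ctx : Set
Ctx = List Pair

-- Derivability in C₂ of  G ⊢ (B , Y).
-- Contexts are multisets: E2 may act on any occurrence, expressed by a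
-- permutation G₀ ↭ (A , X) ∷ G.
data C₂ : Ctx → Pair → Set where
  IN  : ∀ {G B Y} → LKDerivable (B ∷ []) [] → C₂ G (B , Y)
  OUT : ∀ {G B Y} → LKDerivable [] (Y ∷ []) → C₂ G (B , Y)
  E2  : ∀ {G₀ G A X B Y} → G₀ ↭ ((A , X) ∷ G) →
        C₂ G (B ∧f (¬f A) , Y) →
        C₂ G (B , Y ∨f (¬f X)) →
        C₂ G₀ (B , Y)

-- C₂ is sound and complete for the following semantics: G ⊢ (B , Y) is valid
-- when for all valuations v, w with B true at v and Y false at w, some pair
-- (A , X) of G has A true at v and X false at w.  Weakening, contraction and
-- cut obviously preserve validity, so by completeness they are admissible.
-- Completeness inverts E2 semantically until the context is empty; there,
-- validity says that B and ¬ Y are not both satisfiable, and satisfiability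
-- of a formula is decidable because it depends on finitely many atoms.
module Submission where

open import Defs
open import Data.Bool using (Bool; true; false; _∧_; _∨_; not)
open import Data.Bool.Properties using (∧-identityʳ; ∨-identityʳ; not-¬; not-injective)
open import Data.List using ([]; _∷_; _++_)
open import Data.List.Relation.Unary.Any using (Any; here; there; tail)
open import Data.List.Relation.Unary.Any.Properties using (++⁺ˡ; ++⁺ʳ)
open import Data.List.Relation.Binary.Permutation.Propositional using (↭-refl; ↭-sym)
open import Data.List.Relation.Binary.Permutation.Propositional.Properties using (Any-resp-↭)
open import Data.Nat using (ℕ; zero; suc; _≤_; _<_; _⊔_; s≤s)
open import Data.Nat.Properties using (≤-refl; <-≤-trans; m≤m⊔n; m≤n⊔m)
open import Data.Product using (_×_; _,_; ∃; proj₁; proj₂)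
open import Data.Sum using (_⊎_; inj₁; inj₂)
open import Function using (_∘_)
open import Relation.Binary.PropositionalEquality using (_≡_; refl; sym; trans; cong; cong₂)

AgreeBelow : ℕ → Valuation → Valuation → Set
AgreeBelow n v v′ = ∀ i → i < n → v i ≡ v′ i

DependsOnAtomsBelow : ℕ → (Valuation → Bool) → Set
DependsOnAtomsBelow n f = ∀ v v′ → AgreeBelow n v v′ → f v ≡ f v′

depends-below-mono : ∀ {m n f} → m ≤ n → DependsOnAtomsBelow m f → DependsOnAtomsBelow n f
depends-below-mono m≤n dep v v′ agree = dep v v′ (λ i i<m → agree i (<-≤-trans i<m m≤n))

depends-below-⊔ : ∀ {m n f g} (op : Bool → Bool → Bool) →
  DependsOnAtomsBelow m f → DependsOnAtomsBelow n g →
  DependsOnAtomsBelow (m ⊔ n) (λ v → op (f v) (g v))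
depends-below-⊔ {m} {n} op depf depg v v′ agree =
  cong₂ op (depends-below-mono (m≤m⊔n m n) depf v v′ agree)
           (depends-below-mono (m≤n⊔m m n) depg v v′ agree)

atomBound : Fm → ℕ
atomBound (atom n) = suc n
atomBound ⊤f = 0
atomBound ⊥f = 0
atomBound (¬f A) = atomBound A
atomBound (A ∧f B) = atomBound A ⊔ atomBound B
atomBound (A ∨f B) = atomBound A ⊔ atomBound B
atomBound (A →f B) = atomBound A ⊔ atomBound B

⟦⟧-depends-below-atomBound : ∀ A → DependsOnAtomsBelow (atomBound A) ⟦ A ⟧
⟦⟧-depends-below-atomBound (atom n) v v′ agree = agree n ≤-refl
⟦⟧-depends-below-atomBound ⊤f v v′ agree = refl
⟦⟧-depends-below-atomBound ⊥f v v′ agree = refl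
⟦⟧-depends-below-atomBound (¬f A) v v′ agree = cong not (⟦⟧-depends-below-atomBound A v v′ agree)
⟦⟧-depends-below-atomBound (A ∧f B) =
  depends-below-⊔ _∧_ (⟦⟧-depends-below-atomBound A) (⟦⟧-depends-below-atomBound B)
⟦⟧-depends-below-atomBound (A ∨f B) =
  depends-below-⊔ _∨_ (⟦⟧-depends-below-atomBound A) (⟦⟧-depends-below-atomBound B)
⟦⟧-depends-below-atomBound (A →f B) =
  depends-below-⊔ (λ a b → not a ∨ b) (⟦⟧-depends-below-atomBound A) (⟦⟧-depends-below-atomBound B)

Satisfiable : (Valuation → Bool) → Set
Satisfiable f = ∃ λ v → f v ≡ true

Unsatisfiable : (Valuation → Bool) → Set
Unsatisfiable f = ∀ v → f v ≡ false

_∷ᵛ_ : Bool → Valuation → Valuation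
(b ∷ᵛ v) zero = b
(b ∷ᵛ v) (suc i) = v i

∷ᵛ-agreeBelow : ∀ {n v v′} b → AgreeBelow n v v′ → AgreeBelow (suc n) (b ∷ᵛ v) (b ∷ᵛ v′)
∷ᵛ-agreeBelow b agree zero _ = refl
∷ᵛ-agreeBelow b agree (suc i) (s≤s i<n) = agree i i<n

satisfiable-or-unsatisfiable : ∀ n f → DependsOnAtomsBelow n f → Satisfiable f ⊎ Unsatisfiable f
satisfiable-or-unsatisfiable zero f dep with f (λ _ → false) in f✓
... | true = inj₁ (_ , f✓)
... | false = inj₂ (λ v → trans (dep v _ (λ _ ())) f✓)
satisfiable-or-unsatisfiable (suc n) f dep
  with satisfiable-or-unsatisfiable n (f ∘ (true ∷ᵛ_)) (depends-with true)
     | satisfiable-or-unsatisfiable n (f ∘ (false ∷ᵛ_)) (depends-with false)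
  where
  depends-with : ∀ b → DependsOnAtomsBelow n (f ∘ (b ∷ᵛ_))
  depends-with b v v′ agree = dep _ _ (∷ᵛ-agreeBelow b agree)
... | inj₁ (v , f✓) | _ = inj₁ (true ∷ᵛ v , f✓)
... | inj₂ _ | inj₁ (v , f✓) = inj₁ (false ∷ᵛ v , f✓)
... | inj₂ unsat-true | inj₂ unsat-false =
  inj₂ (λ v → trans (dep v (v 0 ∷ᵛ (v ∘ suc)) head∷tail) (unsat-with (v 0) (v ∘ suc)))
  where
  head∷tail : ∀ {v} → AgreeBelow (suc n) v (v 0 ∷ᵛ (v ∘ suc))
  head∷tail zero _ = refl
  head∷tail (suc i) _ = refl
  unsat-with : ∀ b v → f (b ∷ᵛ v) ≡ false
  unsat-with true = unsat-true
  unsat-with false = unsat-false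

satisfiable? : ∀ A → Satisfiable ⟦ A ⟧ ⊎ Unsatisfiable ⟦ A ⟧
satisfiable? A = satisfiable-or-unsatisfiable (atomBound A) ⟦ A ⟧ (⟦⟧-depends-below-atomBound A)

Triggered : Valuation → Valuation → Pair → Set
Triggered v w (A , X) = ⟦ A ⟧ v ≡ true × ⟦ X ⟧ w ≡ false

record Valid (G : Ctx) (p : Pair) : Set where
  field
    triggered : ∀ v w → ⟦ proj₁ p ⟧ v ≡ true → ⟦ proj₂ p ⟧ w ≡ false → Any (Triggered v w) G
open Valid

sound : ∀ {G B Y} → C₂ G (B , Y) → Valid G (B , Y)
triggered (sound (IN B⊨⊥)) v w B✓ Y✗ with B⊨⊥ v (trans (∧-identityʳ _) B✓)
... | ()
triggered (sound (OUT ⊨Y)) v w B✓ Y✗ with trans (sym (cong (_∨ false) Y✗)) (⊨Y w refl)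
... | ()
triggered (sound (E2 {A = A} {X} G₀↭ d₁ d₂)) v w B✓ Y✗ =
  Any-resp-↭ (↭-sym G₀↭) (by-cases (⟦ A ⟧ v) refl (⟦ X ⟧ w) refl)
  where
  by-cases : ∀ a → ⟦ A ⟧ v ≡ a → ∀ x → ⟦ X ⟧ w ≡ x → Any (Triggered v w) ((A , X) ∷ _)
  by-cases false A✗ _ _ = there (triggered (sound d₁) v w (cong₂ (λ b a → b ∧ not a) B✓ A✗) Y✗)
  by-cases true A✓ false X✗ = here (A✓ , X✗)
  by-cases true _ true X✓ = there (triggered (sound d₂) v w B✓ (cong₂ (λ y x → y ∨ not x) Y✗ X✓))

∧-not≡true : ∀ {a b} → a ∧ not b ≡ true → a ≡ true × b ≡ false
∧-not≡true {true} {false} refl = refl , refl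

∨-not≡false : ∀ {a b} → a ∨ not b ≡ false → a ≡ false × b ≡ true
∨-not≡false {false} {true} refl = refl , refl

valid-E2-invˡ : ∀ {G A X B Y} → Valid ((A , X) ∷ G) (B , Y) → Valid G (B ∧f (¬f A) , Y)
triggered (valid-E2-invˡ valid) v w B¬A✓ Y✗ with B✓ , A✗ ← ∧-not≡true B¬A✓ =
  tail (λ (A✓ , _) → not-¬ A✓ A✗) (triggered valid v w B✓ Y✗)

valid-E2-invʳ : ∀ {G A X B Y} → Valid ((A , X) ∷ G) (B , Y) → Valid G (B , Y ∨f (¬f X))
triggered (valid-E2-invʳ valid) v w B✓ Y¬X✗ with Y✗ , X✓ ← ∨-not≡false Y¬X✗ =
  tail (λ (_ , X✗) → not-¬ X✗ X✓) (triggered valid v w B✓ Y✗)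

complete : ∀ G {B Y} → Valid G (B , Y) → C₂ G (B , Y)
complete ((A , X) ∷ G) valid =
  E2 ↭-refl (complete G (valid-E2-invˡ valid)) (complete G (valid-E2-invʳ valid))
complete [] {B} {Y} valid with satisfiable? B | satisfiable? (¬f Y)
... | inj₂ B-unsat | _ = IN (λ v B✓ → trans (sym (B-unsat v)) (trans (sym (∧-identityʳ _)) B✓))
... | inj₁ _ | inj₂ ¬Y-unsat = OUT (λ w _ → trans (∨-identityʳ _) (not-injective (¬Y-unsat w)))
... | inj₁ (v , B✓) | inj₁ (w , ¬Y✓) with triggered valid v w B✓ (not-injective {y = false} ¬Y✓)
...   | ()

valid-weaken : ∀ {G q B Y} → Valid G (B , Y) → Valid (q ∷ G) (B , Y)
triggered (valid-weaken valid) v w B✓ Y✗ = there (triggered valid v w B✓ Y✗)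

valid-contract : ∀ {G q B Y} → Valid (q ∷ q ∷ G) (B , Y) → Valid (q ∷ G) (B , Y)
triggered (valid-contract valid) v w B✓ Y✗ with triggered valid v w B✓ Y✗
... | here t = here t
... | there t = t

valid-cut : ∀ {G G′ C Z B Y} → Valid G (C , Z) → Valid ((C , Z) ∷ G′) (B , Y) → Valid (G ++ G′) (B , Y)
triggered (valid-cut {G} validC validB) v w B✓ Y✗ with triggered validB v w B✓ Y✗
... | here (C✓ , Z✗) = ++⁺ˡ (triggered validC v w C✓ Z✗)
... | there t = ++⁺ʳ G t

lemma3 : (∀ {G A X B Y} → C₂ G (B , Y) → C₂ ((A , X) ∷ G) (B , Y))
    × (∀ {G A X B Y} → C₂ ((A , X) ∷ (A , X) ∷ G) (B , Y) → C₂ ((A , X) ∷ G) (B , Y))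
    × (∀ {G G′ C Z B Y} → C₂ G (C , Z) → C₂ ((C , Z) ∷ G′) (B , Y) → C₂ (G ++ G′) (B , Y))
lemma3 = (λ d → complete _ (valid-weaken (sound d)))
       , (λ d → complete _ (valid-contract (sound d)))
       , (λ d₁ d₂ → complete _ (valid-cut (sound d₁) (sound d₂)))
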